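{- Let $n=2^r$. A sequence in $\mathbb{Z}_{n}$ is an $E$-extremal sequence for $U(n)$ if it is $U(n)$-equivalent to a sequence of length $n+r-1$ in which $2^i$ occurs exactly once for each $i\in[0,r-2]$, there is an odd number $m\in[1,2^r-1]$ such that $2^{r-1}$ occurs exactly $m$ times, and all remaining terms are zero.
   Context: $\mathbb{Z}_n=\mathbb{Z}/n\mathbb{Z}$ and $U(n)$ is its unit group. For $A\subseteq\mathbb{Z}_n$, an $A$-weighted zero-sum subsequence of a sequence $(x_1,\ldots,x_k)$ is given by a non-empty $I\subseteq[1,k]$ and $a_i\in A$ ($i\in I$) with $\sum_{i\in I}a_ix_i=0$; its length is $|I|$. $E_A(n)$ is the least positive integer $k$ such that every sequence of length $k$ in $\mathbb{Z}_n$ has an $A$-weighted zero-sum subsequence of length $n$. An $E$-extremal sequence for $A$ is a sequence of length $E_A(n)-1$ in $\mathbb{Z}_n$ with no $A$-weighted zero-sum subsequence of length $n$. For a subgroup $A$ of $U(n)$, sequences $S=(x_1,\ldots,x_k)$ and $T=(y_1,\ldots,y_k)$ in $\mathbb{Z}_n$ are $A$-equivalent if there exist $c\in U(n)$, a permutation $\sigma$ of $[1,k]$ and $a_1,\ldots,a_k\in A$ with $c\,y_{\sigma(i)}=a_ix_i$ for all $i$. (It is known that $E_{U(n)}(n)=n+\Omega(n)$, so here $E_{U(2^r)}(2^r)=2^r+r$.) -}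

module Defs where

open import Data.Nat using (ℕ; zero; suc; _+_; _*_; _∸_; _^_; _≤_; _<_; _≡ᵇ_)
open import Data.Nat.Divisibility using (_∣_)
open import Data.Nat.Coprimality using (Coprime)
open import Data.Integer as ℤ using (ℤ; +_)
import Data.Integer.Divisibility as ℤD
open import Data.Fin using (Fin; toℕ)
import Data.Fin as Fin
open import Data.Fin.Subset using (Subset; ∣_∣; _∈_)
open import Data.Fin.Subset.Properties using (_∈?_)
open import Data.Fin.Permutation using (Permutation′; _⟨$⟩ʳ_)
open import Data.Bool using (if_then_else_)
open import Data.Product using (Σ; ∃; _×_; _,_)
open import Data.Sum using (_⊎_)
open import Relation.Nullary using (¬_; does)
open import Relation.Binary.PropositionalEquality using (_≡_)

sumFin : (k : ℕ) → (Fin k → ℕ) → ℕ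
sumFin zero    f = 0
sumFin (suc k) f = f Fin.zero + sumFin k (λ i → f (Fin.suc i))

-- Elements of ℤ_n are represented by Fin n (canonical residues 0..n-1).
-- Congruence modulo n of natural numbers (in ℤ_n).
_≡[mod_]_ : ℕ → ℕ → ℕ → Set
a ≡[mod n ] b = (+ n) ℤD.∣ ((+ a) ℤ.- (+ b))

U : (n : ℕ) → Fin n → Set
U n x = Coprime (toℕ x) n

-- A sequence of length k in ℤ_n is a function Fin k → Fin n.
HasWZSLengthN : (n : ℕ) → (A : Fin n → Set) → (k : ℕ) → (Fin k → Fin n) → Set
HasWZSLengthN n A k S =
  Σ (Subset k) λ I → Σ (Fin k → Fin n) λ a →
    (Σ (Fin k) λ i → i ∈ I) × ∣ I ∣ ≡ n × (∀ i → i ∈ I → A (a i)) ×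
    (n ∣ sumFin k (λ i → if does (i ∈? I) then toℕ (a i) * toℕ (S i) else 0))

EveryHasWZS : (n : ℕ) → (A : Fin n → Set) → (k : ℕ) → Set
EveryHasWZS n A k = ∀ (S : Fin k → Fin n) → HasWZSLengthN n A k S

IsE : (n : ℕ) → (A : Fin n → Set) → (E : ℕ) → Set
IsE n A E = 1 ≤ E × EveryHasWZS n A E × (∀ k → 1 ≤ k → EveryHasWZS n A k → E ≤ k)

IsEExtremal : (n : ℕ) → (A : Fin n → Set) → (k : ℕ) → (Fin k → Fin n) → Set
IsEExtremal n A k S = Σ ℕ λ E → IsE n A E × k + 1 ≡ E × ¬ HasWZSLengthN n A k S

AEquivalent : (n : ℕ) → (A : Fin n → Set) → (k : ℕ) → (S T : Fin k → Fin n) → Set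
AEquivalent n A k S T =
  Σ (Fin n) λ c → Σ (Permutation′ k) λ σ → Σ (Fin k → Fin n) λ a →
    U n c × (∀ i → A (a i)) ×
    (∀ i → (toℕ c * toℕ (T (σ ⟨$⟩ʳ i))) ≡[mod n ] (toℕ (a i) * toℕ (S i)))

countVal : (n k : ℕ) → (Fin k → Fin n) → ℕ → ℕ
countVal n k T v = sumFin k (λ j → if toℕ (T j) ≡ᵇ v then 1 else 0)

Odd : ℕ → Set
Odd m = Σ ℕ λ t → m ≡ suc (2 * t)

CanonicalForm : (r k : ℕ) → (Fin k → Fin (2 ^ r)) → Set
CanonicalForm r k T =
  (∀ i → i < r ∸ 1 → countVal (2 ^ r) k T (2 ^ i) ≡ 1) ×
  (Σ ℕ λ m → Odd m × 1 ≤ m × m ≤ 2 ^ r ∸ 1 × countVal (2 ^ r) k T (2 ^ (r ∸ 1)) ≡ m) ×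
  (∀ j → toℕ (T j) ≡ 0 ⊎ (Σ ℕ λ i → i < r × toℕ (T j) ≡ 2 ^ i))

{-# OPTIONS --safe #-}
-- Write x ∈ ℤ_{2^r} as 2^l·u with u odd; this level l ≤ r (with 0 at level r) is invariant under
-- multiplication by units.  If the terms of a subsequence have levels ≥ v, c of them equal to v < r,
-- every odd-weighted sum of them is 2^v·T with T ≡ c (mod 2).  Hence a subsequence of length
-- n = 2^r has a U(n)-weighted zero sum iff its lowest level below r occurs an even number of times,
-- so only the level counts c_0, …, c_r of a sequence matter.  If they sum to n + r a suitable
-- subsequence can always be chosen; if they sum to n + r − 1 this fails exactly when c_ℓ = 1 for
-- ℓ < r − 1 and c_{r−1} is odd and less than n, as for 1, 2, …, 2^{r−1}, 0, …, 0.  Thus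
-- E_{U(n)}(n) = n + r, and replacing each term by 2^{level} (or 0) is a U(n)-equivalence onto the
-- canonical form.
module Submission where

open import Defs
open import Data.Nat
  using (ℕ; NonZero; zero; suc; pred; _⊓_; _+_; _*_; _∸_; _^_; _≤_; _<_; z≤n; s≤s; _≡ᵇ_; ∣_-_∣)
open import Data.Nat.Properties
open import Data.Nat.Divisibility
open import Data.Nat.Coprimality using (Coprime; coprime-divisor)
open import Data.Nat.DivMod using (_%_; _/_; m≡m%n+[m/n]*n; m%n<n)
open import Data.Nat.Primality using (euclidsLemma; prime[2])
import Data.Nat.Tactic.RingSolver as Ring
import Data.Integer as ℤ
import Data.Integer.Properties as ℤ
open import Data.Fin using (Fin; toℕ; fromℕ<) renaming (zero to fzero; suc to fsuc; _≟_ to _≟ᶠ_)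
open import Data.Fin.Properties using (toℕ-fromℕ<; toℕ<n) renaming (suc-injective to fsuc-injective)
open import Data.Fin.Subset using (Subset; ∣_∣; _∈_; inside; outside; Nonempty)
open import Data.Fin.Subset.Properties using (_∈?_; nonempty?; Empty-unique; ∣⊥∣≡0)
open import Data.Fin.Permutation using (Permutation′; _⟨$⟩ʳ_)
import Data.Fin.Permutation as Permutation
open import Data.Vec using ([]; _∷_; here; there)
open import Data.Bool using (if_then_else_)
open import Algebra.Properties.CommutativeSemigroup +-commutativeSemigroup using (interchange)
import Algebra.Properties.CommutativeMonoid.Sum +-0-commutativeMonoid as Sum
open import Data.Product using (Σ; ∃; ∃₂; _×_; _,_; proj₁; proj₂)
open import Data.Sum using (_⊎_; inj₁; inj₂; [_,_]′)
open import Data.Empty using (⊥-elim)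
open import Relation.Nullary using (¬_; yes; no; does; contradiction)
open import Relation.Binary.Definitions using (tri<; tri≈; tri>)
open import Relation.Binary.PropositionalEquality
open import Function using (_∘′_)
open import Function.Bundles using (_⇔_; mk⇔)

private variable
  a b d e k m u v w x y l l′ R N : ℕ
  c : ℕ → ℕ

even-or-odd : ∀ m → 2 ∣ m ⊎ Odd m
even-or-odd zero = inj₁ (2 ∣0)
even-or-odd (suc m) with even-or-odd m
... | inj₁ (divides q refl) = inj₂ (q , cong suc (*-comm q 2))
... | inj₂ (t , refl) = inj₁ (divides (suc t) (sym (2*[1+t]≡ t)))
  where
  2*[1+t]≡ : ∀ t → suc t * 2 ≡ suc (suc (2 * t))
  2*[1+t]≡ = Ring.solve-∀

odd⇒¬2∣ : Odd m → ¬ 2 ∣ m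
odd⇒¬2∣ (t , refl) 2∣m with ∣1⇒≡1 (∣m+n∣m⇒∣n (subst (2 ∣_) (+-comm 1 (2 * t)) 2∣m) (m∣m*n t))
... | ()

¬2∣⇒odd : ¬ 2 ∣ m → Odd m
¬2∣⇒odd {m} ¬2∣m with even-or-odd m
... | inj₁ 2∣m = ⊥-elim (¬2∣m 2∣m)
... | inj₂ odd = odd

odd-* : Odd a → Odd b → Odd (a * b)
odd-* {a} {b} oa ob = ¬2∣⇒odd λ 2∣ab → [ odd⇒¬2∣ oa , odd⇒¬2∣ ob ]′ (euclidsLemma a b prime[2] 2∣ab)

odd-*ˡ : Odd (a * b) → Odd a
odd-*ˡ {a} {b} oab = ¬2∣⇒odd λ 2∣a → odd⇒¬2∣ oab (∣m⇒∣m*n b 2∣a)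

odd-+-even : Odd m → 2 ∣ b → Odd (m + b)
odd-+-even {m} {b} odd 2∣b =
  ¬2∣⇒odd λ 2∣m+b → odd⇒¬2∣ odd (∣m+n∣m⇒∣n (subst (2 ∣_) (+-comm m b) 2∣m+b) 2∣b)

odd⇒1≤ : Odd m → 1 ≤ m
odd⇒1≤ (_ , refl) = s≤s z≤n

odd⇒2∣1+ : Odd m → 2 ∣ 1 + m
odd⇒2∣1+ (t , refl) = divides (suc t) (2+2t≡ t)
  where
  2+2t≡ : ∀ t → 2 + 2 * t ≡ suc t * 2
  2+2t≡ = Ring.solve-∀

odd-*-parity : Odd a → 2 ∣ y + b → 2 ∣ a * y + b
odd-*-parity {y = y} {b} (t , refl) 2∣y+b =
  subst (2 ∣_) (split t y b) (∣m∣n⇒∣m+n (m∣m*n (t * y)) 2∣y+b)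
  where
  split : ∀ t y b → 2 * (t * y) + (y + b) ≡ suc (2 * t) * y + b
  split = Ring.solve-∀

2^-mono-∣ : m ≤ d → 2 ^ m ∣ 2 ^ d
2^-mono-∣ {m} {d} m≤d = divides (2 ^ (d ∸ m)) (begin
  2 ^ d               ≡⟨ cong (2 ^_) (m+[n∸m]≡n m≤d) ⟨
  2 ^ (m + (d ∸ m))   ≡⟨ ^-distribˡ-+-* 2 m (d ∸ m) ⟩
  2 ^ m * 2 ^ (d ∸ m) ≡⟨ *-comm (2 ^ m) _ ⟩
  2 ^ (d ∸ m) * 2 ^ m ∎)
  where open ≡-Reasoning

2^[1+l]∤2^l*odd : Odd u → ¬ 2 ^ suc l ∣ 2 ^ l * u
2^[1+l]∤2^l*odd {u} {l} odd 2^[1+l]∣ = odd⇒¬2∣ odd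
  (*-cancelˡ-∣ (2 ^ l) {{m^n≢0 2 l}} (subst (_∣ 2 ^ l * u) (*-comm 2 (2 ^ l)) 2^[1+l]∣))

odd⇒coprime-2 : Odd a → Coprime a 2
odd⇒coprime-2 odd {zero} (_ , 0∣2) with 0∣⇒≡0 0∣2
... | ()
odd⇒coprime-2 odd {1} _ = refl
odd⇒coprime-2 odd {2} (2∣a , _) = ⊥-elim (odd⇒¬2∣ odd 2∣a)
odd⇒coprime-2 odd {suc (suc (suc _))} (_ , d∣2) with ∣⇒≤ d∣2
... | s≤s (s≤s ())

odd⇒coprime-2^ : ∀ e → Odd a → Coprime a (2 ^ e)
odd⇒coprime-2^ zero odd (_ , d∣1) = ∣1⇒≡1 d∣1
odd⇒coprime-2^ (suc e) odd (d∣a , d∣2*2^e) =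
  odd⇒coprime-2^ e odd (d∣a , coprime-divisor (odd⇒coprime-2 (odd-divisor d∣a odd)) d∣2*2^e)
  where
  odd-divisor : d ∣ a → Odd a → Odd d
  odd-divisor d∣a odd = ¬2∣⇒odd λ 2∣d → odd⇒¬2∣ odd (∣-trans 2∣d d∣a)

coprime-2^[1+e]⇒odd : ∀ e → Coprime a (2 ^ suc e) → Odd a
coprime-2^[1+e]⇒odd e coprime = ¬2∣⇒odd λ 2∣a → contradiction (coprime (2∣a , m∣m*n (2 ^ e))) λ ()

-- l is the 2-adic valuation of x, capped at e: the value 0 gets level e.
IsLevel : ℕ → ℕ → ℕ → Set
IsLevel e x l = (x ≡ 0 × l ≡ e) ⊎ (l < e × ∃ λ u → Odd u × x ≡ 2 ^ l * u)

level-exists : ∀ e x → x < 2 ^ e → ∃ (IsLevel e x)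
level-exists zero zero _ = 0 , inj₁ (refl , refl)
level-exists zero (suc x) (s≤s ())
level-exists (suc e) x x< with even-or-odd x
... | inj₂ odd = 0 , inj₂ (s≤s z≤n , x , odd , sym (+-identityʳ x))
... | inj₁ (divides h refl) with level-exists e h (*-cancelʳ-< 2 h (2 ^ e) (subst (h * 2 <_) (*-comm 2 (2 ^ e)) x<))
...   | _ , inj₁ (refl , refl) = suc e , inj₁ (refl , refl)
...   | l , inj₂ (l<e , u , odd , refl) = suc l , inj₂ (s≤s l<e , u , odd , shift (2 ^ l) u)
  where
  shift : ∀ p u → p * u * 2 ≡ 2 * p * u
  shift = Ring.solve-∀

level-zero : IsLevel e 0 e
level-zero = inj₁ (refl , refl)

level-2^ : ∀ {i} → i < e → IsLevel e (2 ^ i) i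
level-2^ i<e = inj₂ (i<e , 1 , (0 , refl) , sym (*-identityʳ _))

level-≤ : IsLevel e x l → l ≤ e
level-≤ (inj₁ (_ , refl)) = ≤-refl
level-≤ (inj₂ (l<e , _)) = <⇒≤ l<e

level-∣ : IsLevel e x l → 2 ^ l ∣ x
level-∣ (inj₁ (refl , _)) = _ ∣0
level-∣ (inj₂ (_ , u , _ , refl)) = m∣m*n u

level-maximal : IsLevel e x l → Odd w → m ≤ e → 2 ^ m ∣ w * x → m ≤ l
level-maximal (inj₁ (_ , refl)) _ m≤e _ = m≤e
level-maximal {l = l} {w} {m} (inj₂ (_ , u , odd-u , refl)) odd-w _ 2^m∣ with m ≤? l
... | yes m≤l = m≤l
... | no m≰l = ⊥-elim (2^[1+l]∤2^l*odd {l = l} (odd-* odd-w odd-u)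
      (∣-trans (2^-mono-∣ (≰⇒> m≰l)) (subst (2 ^ m ∣_) (swap w (2 ^ l) u) 2^m∣)))
  where
  swap : ∀ w p u → w * (p * u) ≡ p * (w * u)
  swap = Ring.solve-∀

level-unique : IsLevel e x l → IsLevel e x l′ → l ≡ l′
level-unique L L′ = ≤-antisym (below L L′) (below L′ L)
  where
  below : IsLevel e x l → IsLevel e x l′ → l ≤ l′
  below {x = x} L L′ = level-maximal L′ (0 , refl) (level-≤ L) (subst (_ ∣_) (sym (*-identityˡ x)) (level-∣ L))

level-odd-part : IsLevel e x l → l < e → ∃ λ u → Odd u × x ≡ 2 ^ l * u
level-odd-part (inj₁ (_ , refl)) l<e = contradiction l<e (<-irrefl refl)
level-odd-part (inj₂ (_ , odd-part)) _ = odd-part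

∣+m-+n∣≡∣m-n∣ : ∀ m n → ℤ.∣ ℤ.+ m ℤ.- ℤ.+ n ∣ ≡ ∣ m - n ∣
∣+m-+n∣≡∣m-n∣ m n rewrite ℤ.[+m]-[+n]≡m⊖n m n with m ≤? n
... | yes m≤n = trans (ℤ.∣⊖∣-≤ m≤n) (sym (m≤n⇒∣m-n∣≡n∸m m≤n))
... | no m≰n = begin
  ℤ.∣ m ℤ.⊖ n ∣ ≡⟨ ℤ.∣m⊖n∣≡∣n⊖m∣ m n ⟩
  ℤ.∣ n ℤ.⊖ m ∣ ≡⟨ ℤ.∣⊖∣-≰ m≰n ⟩
  m ∸ n         ≡⟨ m≤n⇒∣m-n∣≡n∸m (≰⇒≥ m≰n) ⟨
  ∣ n - m ∣     ≡⟨ ∣-∣-comm n m ⟩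
  ∣ m - n ∣     ∎
  where open ≡-Reasoning

≡mod-from : ∀ {p q} → a + N * p ≡ b + N * q → a ≡[mod N ] b
≡mod-from {a} {N} {b} {p} {q} eq = subst (N ∣_) (sym (begin
  ℤ.∣ ℤ.+ a ℤ.- ℤ.+ b ∣         ≡⟨ ∣+m-+n∣≡∣m-n∣ a b ⟩
  ∣ a - b ∣                     ≡⟨ ∣m+n-m+o∣≡∣n-o∣ (N * p) a b ⟨
  ∣ N * p + a - N * p + b ∣     ≡⟨ cong₂ ∣_-_∣ (trans (+-comm (N * p) a) eq) (+-comm (N * p) b) ⟩
  ∣ b + N * q - b + N * p ∣     ≡⟨ ∣m+n-m+o∣≡∣n-o∣ b (N * q) (N * p) ⟩
  ∣ N * q - N * p ∣             ≡⟨ *-distribˡ-∣-∣ N q p ⟨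
  N * ∣ q - p ∣                 ∎)) (m∣m*n ∣ q - p ∣)
  where open ≡-Reasoning

≡mod-sym : a ≡[mod N ] b → b ≡[mod N ] a
≡mod-sym {a} {N} {b} a≡b = subst (N ∣_) (begin
  ℤ.∣ ℤ.+ a ℤ.- ℤ.+ b ∣ ≡⟨ ∣+m-+n∣≡∣m-n∣ a b ⟩
  ∣ a - b ∣         ≡⟨ ∣-∣-comm a b ⟩
  ∣ b - a ∣         ≡⟨ ∣+m-+n∣≡∣m-n∣ b a ⟨
  ℤ.∣ ℤ.+ b ℤ.- ℤ.+ a ∣ ∎) a≡b
  where open ≡-Reasoning

≡mod-∣ : a ≡[mod N ] b → d ∣ N → d ∣ a → d ∣ b
≡mod-∣ {a} {N} {b} {d} a≡b d∣N d∣a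
  with d∣∣a-b∣ ← ∣-trans d∣N (subst (N ∣_) (∣+m-+n∣≡∣m-n∣ a b) a≡b) | ≤-total a b
... | inj₁ a≤b = ∣m∸n∣n⇒∣m d a≤b (subst (d ∣_) (m≤n⇒∣m-n∣≡n∸m a≤b) d∣∣a-b∣) d∣a
... | inj₂ b≤a = ∣m+n∣m⇒∣n (subst (d ∣_) (sym (m∸n+n≡m b≤a)) d∣a)
                          (subst (d ∣_) (trans (∣-∣-comm a b) (m≤n⇒∣m-n∣≡n∸m b≤a)) d∣∣a-b∣)

level-≤-transfer : IsLevel e x l → IsLevel e y l′ → Odd u →
                   (w * x) ≡[mod 2 ^ e ] (u * y) → l ≤ l′
level-≤-transfer {x = x} {y = y} {u = u} {w = w} Lx Ly odd-u wx≡uy =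
  level-maximal Ly odd-u (level-≤ Lx)
    (≡mod-∣ {w * x} {b = u * y} wx≡uy (2^-mono-∣ (level-≤ Lx)) (∣n⇒∣m*n w (level-∣ Lx)))

level-invariant : IsLevel e x l → IsLevel e y l′ → Odd w → Odd u →
                  (w * x) ≡[mod 2 ^ e ] (u * y) → l ≡ l′
level-invariant {x = x} {y = y} {w = w} {u = u} Lx Ly odd-w odd-u wx≡uy =
  ≤-antisym (level-≤-transfer {w = w} Lx Ly odd-u wx≡uy)
            (level-≤-transfer {w = u} Ly Lx odd-w (≡mod-sym {w * x} {b = u * y} wx≡uy))

odd-inverse : ∀ e → Odd u → ∃₂ λ w p → w * u ≡ 1 + 2 ^ e * p
odd-inverse zero (t , refl) = 1 , 2 * t , refl
odd-inverse {u} (suc e) odd@(s , refl) with odd-inverse e odd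
... | w , p , wu≡ with even-or-odd p
...   | inj₁ (divides q refl) = w , q , trans wu≡ (regroup (2 ^ e) q)
  where
  regroup : ∀ P q → 1 + P * (q * 2) ≡ 1 + 2 * P * q
  regroup = Ring.solve-∀
...   | inj₂ (q , refl) = w + 2 ^ e , q + s + 1 , (begin
  (w + 2 ^ e) * u            ≡⟨ *-distribʳ-+ u w (2 ^ e) ⟩
  w * u + 2 ^ e * u          ≡⟨ cong (_+ 2 ^ e * u) wu≡ ⟩
  1 + 2 ^ e * p + 2 ^ e * u  ≡⟨ regroup (2 ^ e) q s ⟩
  1 + 2 * 2 ^ e * (q + s + 1) ∎)
  where
  open ≡-Reasoning
  regroup : ∀ P q s → 1 + P * suc (2 * q) + P * suc (2 * s) ≡ 1 + 2 * P * (q + s + 1)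
  regroup = Ring.solve-∀

odd-residue : ∀ e {A} → Odd A → Σ (Fin (2 ^ suc e)) λ a → Odd (toℕ a) × ∃ λ q → A ≡ toℕ a + 2 ^ suc e * q
odd-residue e {A} odd = fromℕ< (m%n<n A M) , odd-rem , A / M , (begin
  A                              ≡⟨ m≡m%n+[m/n]*n A M ⟩
  A % M + A / M * M              ≡⟨ cong₂ _+_ (sym (toℕ-fromℕ< (m%n<n A M))) (*-comm (A / M) M) ⟩
  toℕ (fromℕ< (m%n<n A M)) + M * (A / M) ∎)
  where
  open ≡-Reasoning
  M = 2 ^ suc e
  instance
    M≢0 : NonZero M
    M≢0 = m^n≢0 2 (suc e)
  odd-rem : Odd (toℕ (fromℕ< (m%n<n A M)))
  odd-rem = subst Odd (sym (toℕ-fromℕ< (m%n<n A M))) (¬2∣⇒odd λ 2∣rem → odd⇒¬2∣ odd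
    (subst (2 ∣_) (sym (m≡m%n+[m/n]*n A M)) (∣m∣n⇒∣m+n 2∣rem (∣n⇒∣m*n (A / M) (m∣m*n (2 ^ e))))))

inverse⇒odd : ∀ {p} → w * u ≡ 1 + 2 ^ suc e * p → Odd w
inverse⇒odd {w} {u} {e} {p} wu≡ = odd-*ˡ (subst Odd (sym wu≡) (2 ^ e * p , cong suc (*-assoc 2 (2 ^ e) p)))

sumFin-cong : ∀ k {f g : Fin k → ℕ} → (∀ i → f i ≡ g i) → sumFin k f ≡ sumFin k g
sumFin-cong zero f≗g = refl
sumFin-cong (suc k) f≗g = cong₂ _+_ (f≗g fzero) (sumFin-cong k (λ i → f≗g (fsuc i)))

sumFin≡sum : ∀ k f → sumFin k f ≡ Sum.sum f
sumFin≡sum zero f = refl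
sumFin≡sum (suc k) f = cong (f fzero +_) (sumFin≡sum k (λ i → f (fsuc i)))

sumFin-permute : ∀ k f (σ : Permutation′ k) → sumFin k (λ i → f (σ ⟨$⟩ʳ i)) ≡ sumFin k f
sumFin-permute k f σ = begin
  sumFin k (λ i → f (σ ⟨$⟩ʳ i)) ≡⟨ sumFin≡sum k _ ⟩
  Sum.sum (λ i → f (σ ⟨$⟩ʳ i))  ≡⟨ Sum.sum-permute f σ ⟨
  Sum.sum f                     ≡⟨ sumFin≡sum k f ⟨
  sumFin k f                    ∎
  where open ≡-Reasoning

sumIn : ∀ k → Subset k → (Fin k → ℕ) → ℕ
sumIn k I f = sumFin k (λ i → if does (i ∈? I) then f i else 0)

sumIn-cong : ∀ k {I : Subset k} {f g : Fin k → ℕ} → (∀ i → f i ≡ g i) → sumIn k I f ≡ sumIn k I g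
sumIn-cong k {I} f≗g = sumFin-cong k λ i → cong (λ z → if does (i ∈? I) then z else 0) (f≗g i)

sumIn-update : ∀ k {I : Subset k} {f g : Fin k → ℕ} {i} → i ∈ I → (∀ j → j ≢ i → f j ≡ g j) →
               sumIn k I f + g i ≡ sumIn k I g + f i
sumIn-update (suc k) {inside ∷ I} {f} {g} here f≗g = begin
  f fzero + sumIn k I (f ∘′ fsuc) + g fzero
    ≡⟨ cong (λ s → f fzero + s + g fzero) (sumIn-cong k λ j → f≗g (fsuc j) λ ()) ⟩
  f fzero + sumIn k I (g ∘′ fsuc) + g fzero ≡⟨ swap (f fzero) _ (g fzero) ⟩
  g fzero + sumIn k I (g ∘′ fsuc) + f fzero ∎
  where
  open ≡-Reasoning
  swap : ∀ a s b → a + s + b ≡ b + s + a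
  swap = Ring.solve-∀
sumIn-update (suc k) {x ∷ I} {f} {g} {fsuc i} (there i∈I) f≗g = begin
  h f + sumIn k I (f ∘′ fsuc) + g (fsuc i) ≡⟨ +-assoc (h f) _ _ ⟩
  h f + (sumIn k I (f ∘′ fsuc) + g (fsuc i))
    ≡⟨ cong₂ _+_ (cong h′ (f≗g fzero λ ())) (sumIn-update k i∈I λ j j≢i → f≗g (fsuc j) (j≢i ∘′ fsuc-injective)) ⟩
  h g + (sumIn k I (g ∘′ fsuc) + f (fsuc i)) ≡⟨ +-assoc (h g) _ _ ⟨
  h g + sumIn k I (g ∘′ fsuc) + f (fsuc i) ∎
  where
  open ≡-Reasoning
  h′ : ℕ → ℕ
  h′ z = if does (fzero ∈? (x ∷ I)) then z else 0
  h : (Fin (suc k) → ℕ) → ℕ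
  h f = h′ (f fzero)

δ : ℕ → ℕ → ℕ
δ a b = if a ≡ᵇ b then 1 else 0

δ-refl : ∀ a → δ a a ≡ 1
δ-refl zero = refl
δ-refl (suc a) = δ-refl a

δ-≢ : a ≢ b → δ a b ≡ 0
δ-≢ {zero} {zero} a≢b = ⊥-elim (a≢b refl)
δ-≢ {zero} {suc b} _ = refl
δ-≢ {suc a} {zero} _ = refl
δ-≢ {suc a} {suc b} a≢b = δ-≢ (a≢b ∘′ cong suc)

δ-≡ : a ≡ b → δ a b ≡ 1
δ-≡ {a} refl = δ-refl a

sumUpTo : ℕ → (ℕ → ℕ) → ℕ
sumUpTo zero c = c 0
sumUpTo (suc R) c = c 0 + sumUpTo R (c ∘′ suc)

sumUpTo-cong : ∀ R {c d : ℕ → ℕ} → (∀ ℓ → c ℓ ≡ d ℓ) → sumUpTo R c ≡ sumUpTo R d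
sumUpTo-cong zero c≗d = c≗d 0
sumUpTo-cong (suc R) c≗d = cong₂ _+_ (c≗d 0) (sumUpTo-cong R (λ ℓ → c≗d (suc ℓ)))

sumUpTo-+ : ∀ R (c d : ℕ → ℕ) → sumUpTo R (λ ℓ → c ℓ + d ℓ) ≡ sumUpTo R c + sumUpTo R d
sumUpTo-+ zero c d = refl
sumUpTo-+ (suc R) c d = trans (cong (c 0 + d 0 +_) (sumUpTo-+ R _ _)) (interchange (c 0) (d 0) _ _)

sumUpTo-0 : ∀ R → sumUpTo R (λ _ → 0) ≡ 0
sumUpTo-0 zero = refl
sumUpTo-0 (suc R) = sumUpTo-0 R

sumUpTo-δ : ∀ R → x ≤ R → sumUpTo R (δ x) ≡ 1
sumUpTo-δ zero z≤n = refl
sumUpTo-δ {zero} (suc R) _ = cong suc (sumUpTo-0 R)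
sumUpTo-δ {suc x} (suc R) (s≤s x≤R) = sumUpTo-δ R x≤R

δ-cong : (a ≡ b → x ≡ y) → (x ≡ y → a ≡ b) → δ a b ≡ δ x y
δ-cong {a} {b} {x} {y} ⇒ ⇐ with a ≟ b | x ≟ y
... | yes a≡b | yes x≡y = trans (δ-≡ a≡b) (sym (δ-≡ x≡y))
... | no a≢b | no x≢y = trans (δ-≢ a≢b) (sym (δ-≢ x≢y))
... | yes a≡b | no x≢y = contradiction (⇒ a≡b) x≢y
... | no a≢b | yes x≡y = contradiction (⇐ x≡y) a≢b

count : ∀ k → (Fin k → ℕ) → ℕ → ℕ
count k f v = sumFin k (λ i → δ (f i) v)

δ≤1 : ∀ a b → δ a b ≤ 1
δ≤1 a b with a ≟ b
... | yes a≡b = ≤-reflexive (δ-≡ a≡b)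
... | no a≢b = subst (_≤ 1) (sym (δ-≢ a≢b)) z≤n

count≤length : ∀ k f v → count k f v ≤ k
count≤length zero f v = z≤n
count≤length (suc k) f v = +-mono-≤ (δ≤1 (f fzero) v) (count≤length k (f ∘′ fsuc) v)

countIn : ∀ k → Subset k → (Fin k → ℕ) → ℕ → ℕ
countIn k I f v = sumIn k I (λ i → δ (f i) v)

count-total : ∀ k {f : Fin k → ℕ} → (∀ i → f i ≤ R) → sumUpTo R (count k f) ≡ k
count-total {R} zero _ = sumUpTo-0 R
count-total {R} (suc k) f≤R = trans (sumUpTo-+ R _ _)
  (cong₂ _+_ (sumUpTo-δ R (f≤R fzero)) (count-total k (λ i → f≤R (fsuc i))))

countIn-total : ∀ k (I : Subset k) {f : Fin k → ℕ} → (∀ i → f i ≤ R) → sumUpTo R (countIn k I f) ≡ ∣ I ∣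
countIn-total {R} zero [] _ = sumUpTo-0 R
countIn-total {R} (suc k) (inside ∷ I) f≤R = trans (sumUpTo-+ R _ _)
  (cong₂ _+_ (sumUpTo-δ R (f≤R fzero)) (countIn-total k I (λ i → f≤R (fsuc i))))
countIn-total {R} (suc k) (outside ∷ I) f≤R = trans (sumUpTo-+ R _ _)
  (cong₂ _+_ (sumUpTo-0 R) (countIn-total k I (λ i → f≤R (fsuc i))))

countIn≤count : ∀ k (I : Subset k) f v → countIn k I f v ≤ count k f v
countIn≤count zero [] f v = z≤n
countIn≤count (suc k) (inside ∷ I) f v = +-monoʳ-≤ (δ (f fzero) v) (countIn≤count k I (f ∘′ fsuc) v)
countIn≤count (suc k) (outside ∷ I) f v = ≤-trans (countIn≤count k I (f ∘′ fsuc) v) (m≤n+m _ _)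

countIn-select : ∀ k (f : Fin k → ℕ) (j : ℕ → ℕ) → (∀ ℓ → j ℓ ≤ count k f ℓ) →
                 ∃ λ I → ∀ ℓ → countIn k I f ℓ ≡ j ℓ
countIn-select zero f j j≤ = [] , λ ℓ → sym (n≤0⇒n≡0 (j≤ ℓ))
countIn-select (suc k) f j j≤ with j (f fzero) in jf≡
... | zero = let I , I≗j = countIn-select k (f ∘′ fsuc) j skip in outside ∷ I , I≗j
  where
  skip : ∀ ℓ → j ℓ ≤ count k (f ∘′ fsuc) ℓ
  skip ℓ with f fzero ≟ ℓ
  ... | yes refl = subst (_≤ _) (sym jf≡) z≤n
  ... | no f0≢ℓ = subst (λ z → j ℓ ≤ z + count k (f ∘′ fsuc) ℓ) (δ-≢ f0≢ℓ) (j≤ ℓ)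
... | suc _ = let I , I≗j′ = countIn-select k (f ∘′ fsuc) j′ take in inside ∷ I , λ ℓ →
  trans (cong (δ (f fzero) ℓ +_) (I≗j′ ℓ)) (restore ℓ)
  where
  j′ : ℕ → ℕ
  j′ ℓ = j ℓ ∸ δ (f fzero) ℓ
  take : ∀ ℓ → j′ ℓ ≤ count k (f ∘′ fsuc) ℓ
  take ℓ = subst (j′ ℓ ≤_) (m+n∸m≡n (δ (f fzero) ℓ) _) (∸-monoˡ-≤ (δ (f fzero) ℓ) (j≤ ℓ))
  restore : ∀ ℓ → δ (f fzero) ℓ + j′ ℓ ≡ j ℓ
  restore ℓ with f fzero ≟ ℓ
  ... | yes refl rewrite δ-refl (f fzero) | jf≡ = refl
  ... | no f0≢ℓ rewrite δ-≢ f0≢ℓ = refl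

countIn-∉ : ∀ k (I : Subset k) f v → (∀ i → i ∈ I → f i ≢ v) → countIn k I f v ≡ 0
countIn-∉ zero [] f v _ = refl
countIn-∉ (suc k) (outside ∷ I) f v ∉ = countIn-∉ k I (f ∘′ fsuc) v (λ i i∈I → ∉ (fsuc i) (there i∈I))
countIn-∉ (suc k) (inside ∷ I) f v ∉ =
  cong₂ _+_ (δ-≢ (∉ fzero here)) (countIn-∉ k I (f ∘′ fsuc) v (λ i i∈I → ∉ (fsuc i) (there i∈I)))

countIn-≡0 : ∀ k (I : Subset k) f v → countIn k I f v ≡ 0 → ∀ i → i ∈ I → f i ≢ v
countIn-≡0 (suc k) (inside ∷ I) f v c≡0 fzero here refl with () ← trans (sym (δ-refl (f fzero))) (m+n≡0⇒m≡0 _ c≡0)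
countIn-≡0 (suc k) (inside ∷ I) f v c≡0 (fsuc i) (there i∈I) =
  countIn-≡0 k I (f ∘′ fsuc) v (m+n≡0⇒n≡0 (δ (f fzero) v) c≡0) i i∈I
countIn-≡0 (suc k) (outside ∷ I) f v c≡0 (fsuc i) (there i∈I) = countIn-≡0 k I (f ∘′ fsuc) v c≡0 i i∈I

countIn-lowest : ∀ k (I : Subset k) f → (∀ u → u < v → countIn k I f u ≡ 0) → ∀ i → i ∈ I → v ≤ f i
countIn-lowest k I f none-below i i∈I = ≮⇒≥ λ fi<v → countIn-≡0 k I f (f i) (none-below (f i) fi<v) i i∈I refl

countIn-≢0 : ∀ k (I : Subset k) f v → countIn k I f v ≢ 0 → ∃ λ i → i ∈ I × f i ≡ v
countIn-≢0 zero [] f v c≢0 = ⊥-elim (c≢0 refl)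
countIn-≢0 (suc k) (outside ∷ I) f v c≢0 =
  let i , i∈I , fi≡v = countIn-≢0 k I (f ∘′ fsuc) v c≢0 in fsuc i , there i∈I , fi≡v
countIn-≢0 (suc k) (inside ∷ I) f v c≢0 with f fzero ≟ v
... | yes f0≡v = fzero , here , f0≡v
... | no f0≢v =
  let i , i∈I , fi≡v = countIn-≢0 k I (f ∘′ fsuc) v (c≢0 ∘′ trans (cong (_+ countIn k I (f ∘′ fsuc) v) (δ-≢ f0≢v)))
  in fsuc i , there i∈I , fi≡v

level-split : IsLevel e x l → v ≤ l → v < e → ∃ λ y → x ≡ 2 ^ v * y × 2 ∣ y + δ l v
level-split {v = v} (inj₁ (refl , refl)) _ v<e =
  0 , sym (*-zeroʳ (2 ^ v)) , subst (2 ∣_) (sym (δ-≢ (>⇒≢ v<e))) (2 ∣0)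
level-split {v = v} (inj₂ (_ , u , odd , refl)) v≤l _ with d , refl ← m≤n⇒∃[o]m+o≡n v≤l with d
... | zero = u , cong (λ e → 2 ^ e * u) (+-identityʳ v) ,
             subst (λ z → 2 ∣ u + z) (sym (δ-≡ (+-identityʳ v))) (subst (2 ∣_) (+-comm 1 u) (odd⇒2∣1+ odd))
... | suc d = 2 ^ suc d * u , trans (cong (_* u) (^-distribˡ-+-* 2 v (suc d))) (*-assoc (2 ^ v) _ u) ,
              subst (λ z → 2 ∣ 2 ^ suc d * u + z) (sym (δ-≢ (m+1+n≢m v)))
                (subst (2 ∣_) (sym (+-identityʳ _)) (∣m⇒∣m*n u (m∣m*n (2 ^ d))))

sumUpTo-ones : ∀ R c → (∀ ℓ → ℓ < R → c ℓ ≡ 1) → sumUpTo (suc R) c ≡ R + (c R + c (suc R))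
sumUpTo-ones zero c _ = refl
sumUpTo-ones (suc R) c ones =
  cong₂ _+_ (ones 0 (s≤s z≤n)) (sumUpTo-ones R (c ∘′ suc) λ ℓ ℓ<R → ones (suc ℓ) (s≤s ℓ<R))

-- j ℓ is the number of terms of level ℓ in a subsequence.
Admissible : ℕ → (ℕ → ℕ) → Set
Admissible R j = ∀ v → v < R → (∀ u → u < v → j u ≡ 0) → 2 ∣ j v

Selectable : ℕ → ℕ → (ℕ → ℕ) → Set
Selectable R N c = ∃ λ j → (∀ ℓ → j ℓ ≤ c ℓ) × sumUpTo R j ≡ N × Admissible R j

cons : ℕ → (ℕ → ℕ) → ℕ → ℕ
cons x c zero = x
cons x c (suc ℓ) = c ℓ

sub-with-sum : ∀ R c {N} → N ≤ sumUpTo R c → ∃ λ j → (∀ ℓ → j ℓ ≤ c ℓ) × sumUpTo R j ≡ N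
sub-with-sum zero c N≤c = cons _ (λ _ → 0) , (λ { zero → N≤c ; (suc ℓ) → z≤n }) , refl
sub-with-sum (suc R) c {N} N≤ with N ≤? c 0
... | yes N≤c0 = cons N (λ _ → 0) , (λ { zero → N≤c0 ; (suc ℓ) → z≤n }) ,
                 trans (cong (N +_) (sumUpTo-0 R)) (+-identityʳ N)
... | no N≰c0 with d , c0+d≡N ← m≤n⇒∃[o]m+o≡n (<⇒≤ (≰⇒> N≰c0))
                 with j , j≤ , Σj ← sub-with-sum R (c ∘′ suc) {d}
                        (+-cancelˡ-≤ (c 0) d _ (subst (_≤ c 0 + _) (sym c0+d≡N) N≤)) =
  cons (c 0) j , (λ { zero → ≤-refl ; (suc ℓ) → j≤ ℓ }) , trans (cong (c 0 +_) Σj) c0+d≡N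

selectable-suc : Selectable R N (c ∘′ suc) → Selectable (suc R) N c
selectable-suc {R} (j , j≤ , Σj , adm) = cons 0 j , (λ { zero → z≤n ; (suc ℓ) → j≤ ℓ }) , Σj , adm′
  where
  adm′ : Admissible (suc R) (cons 0 j)
  adm′ zero _ _ = 2 ∣0
  adm′ (suc v) (s≤s v<R) below = adm v v<R (λ u u<v → below (suc u) (s≤s u<v))

selectable-even-base : ∀ R c {e f} → 2 ∣ e → 1 ≤ e → e ≤ c 0 → f ≤ sumUpTo R (c ∘′ suc) →
                       Selectable (suc R) (e + f) c
selectable-even-base R c {e} 2∣e 1≤e e≤c0 f≤ with j , j≤ , Σj ← sub-with-sum R (c ∘′ suc) f≤ =
  cons e j , (λ { zero → e≤c0 ; (suc ℓ) → j≤ ℓ }) , cong (e +_) Σj , adm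
  where
  adm : Admissible (suc R) (cons e j)
  adm zero _ _ = 2∣e
  adm (suc v) _ below = contradiction (below 0 (s≤s z≤n)) (m<n⇒n≢0 1≤e)

even-part : 2 ≤ m → ∃ λ e → 2 ∣ e × 1 ≤ e × e ≤ m × m ≤ suc e
even-part {m} 2≤m with even-or-odd m
... | inj₁ 2∣m = m , 2∣m , ≤-trans (s≤s z≤n) 2≤m , ≤-refl , n≤1+n m
... | inj₂ (suc t , refl) = 2 * suc t , divides (suc t) (*-comm 2 (suc t)) , s≤s z≤n , n≤1+n _ , ≤-refl
... | inj₂ (zero , refl) with s≤s () ← 2≤m

split-even : ∀ {m T} → 2 ∣ N → 1 ≤ N → 2 ≤ m → N + 1 ≤ m + T →
             ∃₂ λ e f → 2 ∣ e × 1 ≤ e × e ≤ m × f ≤ T × e + f ≡ N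
split-even {N} {m} 2∣N 1≤N 2≤m N+1≤ with N ≤? m
... | yes N≤m = N , 0 , 2∣N , 1≤N , N≤m , z≤n , +-identityʳ N
... | no N≰m with e , 2∣e , 1≤e , e≤m , m≤1+e ← even-part 2≤m
             with f , e+f≡N ← m≤n⇒∃[o]m+o≡n (≤-trans e≤m (<⇒≤ (≰⇒> N≰m))) =
  e , f , 2∣e , 1≤e , e≤m , +-cancelˡ-≤ e f _ (≤-pred e+f<) , e+f≡N
  where
  e+f< : suc (e + f) ≤ suc (e + _)
  e+f< = begin
    suc (e + f) ≡⟨ cong suc e+f≡N ⟩
    suc N       ≡⟨ +-comm 1 N ⟩
    N + 1       ≤⟨ N+1≤ ⟩
    m + _       ≤⟨ +-monoˡ-≤ _ m≤1+e ⟩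
    suc (e + _) ∎
    where open ≤-Reasoning

selectable-if-long : ∀ R c → 2 ∣ N → 1 ≤ N → N + R ≤ sumUpTo R c → Selectable R N c
selectable-if-long {N} zero c _ _ N+0≤c0 =
  cons N (λ _ → 0) , (λ { zero → subst (_≤ c 0) (+-identityʳ N) N+0≤c0 ; (suc ℓ) → z≤n }) , refl , λ _ ()
selectable-if-long {N} (suc R) c 2∣N 1≤N long with c 0 ≤? 1
... | yes c0≤1 = selectable-suc (selectable-if-long R (c ∘′ suc) 2∣N 1≤N
  (+-cancelˡ-≤ 1 _ _ (subst (_≤ 1 + sumUpTo R (c ∘′ suc)) (+-suc N R)
                             (≤-trans long (+-monoˡ-≤ (sumUpTo R (c ∘′ suc)) c0≤1)))))
... | no c0≰1 with e , f , 2∣e , 1≤e , e≤c0 , f≤ , e+f≡N ←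
                   split-even 2∣N 1≤N (≰⇒> c0≰1) (≤-trans (+-monoʳ-≤ N (s≤s z≤n)) long) =
  subst (λ N → Selectable (suc R) N c) e+f≡N (selectable-even-base R c 2∣e 1≤e e≤c0 f≤)

Shape : ℕ → (ℕ → ℕ) → ℕ → Set
Shape R c N = (∀ ℓ → ℓ < R → c ℓ ≡ 1) × Odd (c R) × c R < N

unselectable⇒shape : ∀ R c → 2 ∣ N → 1 ≤ N → sumUpTo (suc R) c ≡ N + R →
                     ¬ Selectable (suc R) N c → Shape R c N
unselectable⇒shape {N} zero c 2∣N 1≤N Σc ¬sel with even-or-odd (c 0)
... | inj₂ odd = (λ _ ()) , odd , ≤∧≢⇒< c0≤N λ c0≡N → odd⇒¬2∣ odd (subst (2 ∣_) (sym c0≡N) 2∣N)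
  where
  c0≤N : c 0 ≤ N
  c0≤N = subst (c 0 ≤_) (trans Σc (+-identityʳ N)) (m≤m+n (c 0) (c 1))
... | inj₁ 2∣c0 with c 0 ≟ 0
...   | yes c0≡0 = contradiction (selectable-suc (selectable-if-long 0 (c ∘′ suc) 2∣N 1≤N
                     (≤-reflexive (trans (sym Σc) (cong (_+ c 1) c0≡0))))) ¬sel
...   | no c0≢0 = contradiction (subst (λ N → Selectable 1 N c) (trans Σc (+-identityʳ N))
                     (selectable-even-base 0 c 2∣c0 (n≢0⇒n>0 c0≢0) ≤-refl ≤-refl)) ¬sel
unselectable⇒shape {N} (suc R) c 2∣N 1≤N Σc ¬sel with <-cmp (c 0) 1
... | tri< c0<1 _ _ = contradiction (selectable-suc (selectable-if-long (suc R) (c ∘′ suc) 2∣N 1≤N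
                        (≤-reflexive (trans (sym Σc) (cong (_+ sumUpTo (suc R) (c ∘′ suc)) (n<1⇒n≡0 c0<1)))))) ¬sel
... | tri≈ _ c0≡1 _ with ones , odd , cR<N ← unselectable⇒shape R (c ∘′ suc) 2∣N 1≤N
                        (suc-injective (trans (cong (_+ sumUpTo (suc R) (c ∘′ suc)) (sym c0≡1)) (trans Σc (+-suc N R))))
                        (¬sel ∘′ selectable-suc) =
  (λ { zero _ → c0≡1 ; (suc ℓ) (s≤s ℓ<R) → ones ℓ ℓ<R }) , odd , cR<N
... | tri> _ _ 1<c0 with e , f , 2∣e , 1≤e , e≤c0 , f≤ , e+f≡N ←
                         split-even 2∣N 1≤N 1<c0 (≤-trans (+-monoʳ-≤ N (s≤s z≤n)) (≤-reflexive (sym Σc))) =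
  contradiction (subst (λ N → Selectable (suc (suc R)) N c) e+f≡N (selectable-even-base (suc R) c 2∣e 1≤e e≤c0 f≤)) ¬sel

even≤1⇒≡0 : 2 ∣ m → m ≤ 1 → m ≡ 0
even≤1⇒≡0 {zero} _ _ = refl
even≤1⇒≡0 {suc zero} 2∣1 _ = ⊥-elim (odd⇒¬2∣ (0 , refl) 2∣1)
even≤1⇒≡0 {suc (suc _)} _ (s≤s ())

thin⇒unselectable : ∀ R c → Odd m → (∀ ℓ → ℓ < R → c ℓ ≤ 1) → c R ≤ m → c (suc R) + m ≤ N →
                    ¬ Selectable (suc R) N c
thin⇒unselectable {m} {N} zero c odd _ c0≤m c1+m≤N (j , j≤ , Σj , adm) = <-irrefl Σj (begin-strict
  j 0 + j 1 <⟨ +-mono-<-≤ j0<m (j≤ 1) ⟩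
  m + c 1   ≡⟨ +-comm m (c 1) ⟩
  c 1 + m   ≤⟨ c1+m≤N ⟩
  N         ∎)
  where
  open ≤-Reasoning
  j0<m : j 0 < m
  j0<m = ≤∧≢⇒< (≤-trans (j≤ 0) c0≤m) λ j0≡m → odd⇒¬2∣ odd (subst (2 ∣_) j0≡m (adm 0 (s≤s z≤n) λ _ ()))
thin⇒unselectable (suc R) c odd ≤1 cR≤m tail≤N (j , j≤ , Σj , adm) =
  thin⇒unselectable R (c ∘′ suc) odd (λ ℓ ℓ<R → ≤1 (suc ℓ) (s≤s ℓ<R)) cR≤m tail≤N
    (j ∘′ suc , (λ ℓ → j≤ (suc ℓ)) , trans (cong (_+ sumUpTo (suc R) (j ∘′ suc)) (sym j0≡0)) Σj , adm′)
  where
  j0≡0 : j 0 ≡ 0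
  j0≡0 = even≤1⇒≡0 (adm 0 (s≤s z≤n) λ _ ()) (≤-trans (j≤ 0) (≤1 0 (s≤s z≤n)))
  adm′ : Admissible (suc R) (j ∘′ suc)
  adm′ v v<R below = adm (suc v) (s≤s v<R) λ { zero _ → j0≡0 ; (suc u) (s≤s u<v) → below u u<v }

completion-arithmetic : ∀ {s P T u a q w p Z} →
  s + 1 * (P * u) ≡ P * T + a * (P * u) → w * u ≡ 1 + N * p → a + N * q ≡ w * Z → Z + T ≡ u + N * T →
  N * (P * q * u) + s ≡ N * (P * (T + p * Z))
completion-arithmetic {N} {s} {P} {T} {u} {a} {q} {w} {p} {Z} updated inverse residue Z+T≡ =
  +-cancelˡ-≡ (1 * (P * u)) _ _ (begin
    1 * (P * u) + (N * (P * q * u) + s)   ≡⟨ step₁ s (P * u) (N * (P * q * u)) ⟩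
    s + 1 * (P * u) + N * (P * q * u)     ≡⟨ cong (_+ N * (P * q * u)) updated ⟩
    P * T + a * (P * u) + N * (P * q * u) ≡⟨ step₂ P T a u N q ⟩
    P * T + P * u * (a + N * q)           ≡⟨ cong (λ z → P * T + P * u * z) residue ⟩
    P * T + P * u * (w * Z)               ≡⟨ step₃ P T u w Z ⟩
    P * T + P * Z * (w * u)               ≡⟨ cong (λ z → P * T + P * Z * z) inverse ⟩
    P * T + P * Z * (1 + N * p)           ≡⟨ step₄ P T Z N p ⟩
    P * (Z + T) + N * (P * (p * Z))       ≡⟨ cong (λ z → P * z + N * (P * (p * Z))) Z+T≡ ⟩
    P * (u + N * T) + N * (P * (p * Z))   ≡⟨ step₅ P u N T p Z ⟩
    1 * (P * u) + N * (P * (T + p * Z))   ∎)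
  where
  open ≡-Reasoning
  step₁ : ∀ s x y → 1 * x + (y + s) ≡ s + 1 * x + y
  step₁ = Ring.solve-∀
  step₂ : ∀ P T a u N q → P * T + a * (P * u) + N * (P * q * u) ≡ P * T + P * u * (a + N * q)
  step₂ = Ring.solve-∀
  step₃ : ∀ P T u w Z → P * T + P * u * (w * Z) ≡ P * T + P * Z * (w * u)
  step₃ = Ring.solve-∀
  step₄ : ∀ P T Z N p → P * T + P * Z * (1 + N * p) ≡ P * (Z + T) + N * (P * (p * Z))
  step₄ = Ring.solve-∀
  step₅ : ∀ P u N T p Z → P * (u + N * T) + N * (P * (p * Z)) ≡ 1 * (P * u) + N * (P * (T + p * Z))
  step₅ = Ring.solve-∀

module _ (g : ℕ) where

  private
    r : ℕ
    r = suc g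
    n : ℕ
    n = 2 ^ r
    instance
      n≢0 : NonZero n
      n≢0 = m^n≢0 2 r

  lvl : Fin n → ℕ
  lvl x = proj₁ (level-exists r (toℕ x) (toℕ<n x))

  lvl-spec : ∀ x → IsLevel r (toℕ x) (lvl x)
  lvl-spec x = proj₂ (level-exists r (toℕ x) (toℕ<n x))

  lvl≤r : ∀ x → lvl x ≤ r
  lvl≤r x = level-≤ (lvl-spec x)

  levels : (Fin k → Fin n) → Fin k → ℕ
  levels S i = lvl (S i)

  HasZeroSum : ∀ k → (Fin k → Fin n) → Set
  HasZeroSum = HasWZSLengthN n (U n)

  weighted-sum : ∀ k → Subset k → (Fin k → ℕ) → (Fin k → Fin n) → ℕ
  weighted-sum k I A S = sumIn k I (λ i → A i * toℕ (S i))

  weighted-sum-divisible : ∀ k (I : Subset k) A S → (∀ i → i ∈ I → v ≤ lvl (S i)) →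
                           2 ^ v ∣ weighted-sum k I A S
  weighted-sum-divisible zero [] A S _ = _ ∣0
  weighted-sum-divisible (suc k) (outside ∷ I) A S above =
    weighted-sum-divisible k I (A ∘′ fsuc) (S ∘′ fsuc) (λ i i∈I → above (fsuc i) (there i∈I))
  weighted-sum-divisible (suc k) (inside ∷ I) A S above = ∣m∣n⇒∣m+n
    (∣n⇒∣m*n (A fzero) (∣-trans (2^-mono-∣ (above fzero here)) (level-∣ (lvl-spec (S fzero)))))
    (weighted-sum-divisible k I (A ∘′ fsuc) (S ∘′ fsuc) (λ i i∈I → above (fsuc i) (there i∈I)))

  weighted-sum-parity : ∀ k (I : Subset k) A S → v < r → (∀ i → i ∈ I → Odd (A i)) →
                        (∀ i → i ∈ I → v ≤ lvl (S i)) →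
                        ∃ λ T → weighted-sum k I A S ≡ 2 ^ v * T × 2 ∣ T + countIn k I (levels S) v
  weighted-sum-parity {v} zero [] A S _ _ _ = 0 , sym (*-zeroʳ (2 ^ v)) , 2 ∣0
  weighted-sum-parity (suc k) (outside ∷ I) A S v<r odd above =
    weighted-sum-parity k I (A ∘′ fsuc) (S ∘′ fsuc) v<r
      (λ i i∈I → odd (fsuc i) (there i∈I)) (λ i i∈I → above (fsuc i) (there i∈I))
  weighted-sum-parity {v} (suc k) (inside ∷ I) A S v<r odd above
    with T , ΣI≡ , 2∣T+c ← weighted-sum-parity k I (A ∘′ fsuc) (S ∘′ fsuc) v<r
                              (λ i i∈I → odd (fsuc i) (there i∈I)) (λ i i∈I → above (fsuc i) (there i∈I))
       | y , x≡ , 2∣y+δ ← level-split (lvl-spec (S fzero)) (above fzero here) v<r =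
    A fzero * y + T ,
    trans (cong₂ _+_ (trans (cong (A fzero *_) x≡) (*-comm-middle (A fzero) (2 ^ v) y)) ΣI≡) (sym (*-distribˡ-+ (2 ^ v) _ T)) ,
    subst (2 ∣_) (interchange (A fzero * y) (δ (lvl (S fzero)) v) T _)
      (∣m∣n⇒∣m+n (odd-*-parity (odd fzero here) 2∣y+δ) 2∣T+c)
    where
    *-comm-middle : ∀ a p y → a * (p * y) ≡ p * (a * y)
    *-comm-middle = Ring.solve-∀

  zero-sum⇒admissible : ∀ k S → HasZeroSum k S → ∃ λ I → ∣ I ∣ ≡ n × Admissible r (countIn k I (levels S))
  zero-sum⇒admissible k S (I , a , _ , card , units , n∣Σ) = I , card , admissible
    where
    admissible : Admissible r (countIn k I (levels S))
    admissible v v<r none-below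
      with T , Σ≡ , 2∣T+c ← weighted-sum-parity k I (toℕ ∘′ a) S v<r
                              (λ i i∈I → coprime-2^[1+e]⇒odd g (units i i∈I)) (countIn-lowest k I (levels S) none-below) =
      ∣m+n∣m⇒∣n 2∣T+c (*-cancelˡ-∣ (2 ^ v) {{m^n≢0 2 v}}
        (subst (_∣ 2 ^ v * T) (*-comm 2 (2 ^ v)) (∣-trans (2^-mono-∣ v<r) (subst (n ∣_) Σ≡ n∣Σ))))

  1<n : 1 < n
  1<n = *-monoʳ-≤ 2 (m^n>0 2 g)

  one : Fin n
  one = fromℕ< 1<n

  toℕ-one : toℕ one ≡ 1
  toℕ-one = toℕ-fromℕ< 1<n

  odd-one : Odd (toℕ one)
  odd-one = subst Odd (sym toℕ-one) (0 , refl)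

  ZeroSumWeights : ∀ k → Subset k → (Fin k → Fin n) → Set
  ZeroSumWeights k I S =
    Σ (Fin k → Fin n) λ a → (∀ i → i ∈ I → Odd (toℕ (a i))) × n ∣ weighted-sum k I (toℕ ∘′ a) S

  oneExcept : Fin k → Fin n → Fin k → Fin n
  oneExcept i₀ a i with i ≟ᶠ i₀
  ... | yes _ = a
  ... | no _ = one

  oneExcept-odd : ∀ {i₀ : Fin k} {a} → Odd (toℕ a) → ∀ i → Odd (toℕ (oneExcept i₀ a i))
  oneExcept-odd {i₀ = i₀} odd-a i with i ≟ᶠ i₀
  ... | yes _ = odd-a
  ... | no _ = odd-one

  weighted-sum-oneExcept : ∀ k I S {i₀} a → i₀ ∈ I →
    weighted-sum k I (toℕ ∘′ oneExcept i₀ a) S + 1 * toℕ (S i₀) ≡ weighted-sum k I (λ _ → 1) S + toℕ a * toℕ (S i₀)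
  weighted-sum-oneExcept k I S {i₀} a i₀∈I = begin
    weighted-sum k I (toℕ ∘′ oneExcept i₀ a) S + 1 * toℕ (S i₀)        ≡⟨ sumIn-update k i₀∈I agree ⟩
    weighted-sum k I (λ _ → 1) S + toℕ (oneExcept i₀ a i₀) * toℕ (S i₀)
      ≡⟨ cong (λ b → weighted-sum k I (λ _ → 1) S + toℕ b * toℕ (S i₀)) at-i₀ ⟩
    weighted-sum k I (λ _ → 1) S + toℕ a * toℕ (S i₀)                   ∎
    where
    open ≡-Reasoning
    agree : ∀ j → j ≢ i₀ → toℕ (oneExcept i₀ a j) * toℕ (S j) ≡ 1 * toℕ (S j)
    agree j j≢i₀ with j ≟ᶠ i₀
    ... | yes j≡i₀ = contradiction j≡i₀ j≢i₀
    ... | no _ = cong (_* toℕ (S j)) toℕ-one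
    at-i₀ : oneExcept i₀ a i₀ ≡ a
    at-i₀ with i₀ ≟ᶠ i₀
    ... | yes _ = refl
    ... | no i₀≢i₀ = contradiction refl i₀≢i₀

  -- With weight 1 everywhere the sum is 2^v·T with T even.  Changing the weight of one term
  -- 2^v·u of level v to a ≡ u⁻¹·(u − T) (mod n), which is odd, makes the sum divisible by n.
  zero-sum-weights-at : ∀ k I S → v < r → (∀ i → i ∈ I → v ≤ lvl (S i)) →
                        2 ∣ countIn k I (levels S) v → countIn k I (levels S) v ≢ 0 → ZeroSumWeights k I S
  zero-sum-weights-at {v} k I S v<r above 2∣c c≢0
    with i₀ , i₀∈I , lvl≡v ← countIn-≢0 k I (levels S) v c≢0
       | T , Σ₁≡ , 2∣T+c ← weighted-sum-parity k I (λ _ → 1) S v<r (λ _ _ → 0 , refl) above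
    with u , odd-u , x≡ ← level-odd-part (subst (IsLevel r _) lvl≡v (lvl-spec (S i₀))) v<r
    with w , p , wu≡ ← odd-inverse r odd-u
       | 2∣T ← ∣m+n∣m⇒∣n (subst (2 ∣_) (+-comm T (countIn k I (levels S) v)) 2∣T+c) 2∣c
    with a , odd-a , q , wZ≡ ← odd-residue g (odd-* (inverse⇒odd {w} {u} {g} wu≡)
                                                    (odd-+-even odd-u (∣n⇒∣m*n (pred n) 2∣T))) =
    oneExcept i₀ a , (λ i _ → oneExcept-odd odd-a i) , ∣m+n∣m⇒∣n n∣n*_+total (m∣m*n _)
    where
    Z+T≡ : u + pred n * T + T ≡ u + n * T
    Z+T≡ = trans (+-assoc u _ T) (cong (u +_) (trans (+-comm _ T) (cong (_* T) (suc-pred n))))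
    total : ℕ
    total = weighted-sum k I (toℕ ∘′ oneExcept i₀ a) S
    updated : total + 1 * (2 ^ v * u) ≡ 2 ^ v * T + toℕ a * (2 ^ v * u)
    updated = subst (λ x → total + 1 * x ≡ 2 ^ v * T + toℕ a * x) x≡
                    (trans (weighted-sum-oneExcept k I S a i₀∈I) (cong (_+ toℕ a * toℕ (S i₀)) Σ₁≡))
    n∣n*_+total : n ∣ n * (2 ^ v * q * u) + total
    n∣n*_+total = subst (n ∣_) (sym (completion-arithmetic {n} {total} {2 ^ v} {T} {u} {w = w} updated wu≡ (sym wZ≡) Z+T≡))
                    (m∣m*n _)

  -- Search upwards from level v, d = r − v, for the lowest level occurring in I.
  zero-sum-weights : ∀ d k I S → v + d ≡ r → (∀ i → i ∈ I → v ≤ lvl (S i)) →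
                     Admissible r (countIn k I (levels S)) → ZeroSumWeights k I S
  zero-sum-weights {v} zero k I S v+0≡r above _ = (λ _ → one) , (λ _ _ → odd-one) ,
    weighted-sum-divisible k I (λ _ → toℕ one) S
      (λ i i∈I → subst (_≤ lvl (S i)) (trans (sym (+-identityʳ v)) v+0≡r) (above i i∈I))
  zero-sum-weights {v} (suc d) k I S v+d≡r above admissible with countIn k I (levels S) v ≟ 0
  ... | yes c≡0 = zero-sum-weights d k I S (trans (sym (+-suc v d)) v+d≡r)
    (λ i i∈I → ≤∧≢⇒< (above i i∈I) λ v≡ → countIn-≡0 k I (levels S) v c≡0 i i∈I (sym v≡)) admissible
  ... | no c≢0 = zero-sum-weights-at k I S v<r above (admissible v v<r none-below) c≢0
    where
    v<r : v < r
    v<r = subst (v <_) v+d≡r (m<m+n v (s≤s z≤n))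
    none-below : ∀ u → u < v → countIn k I (levels S) u ≡ 0
    none-below u u<v = countIn-∉ k I (levels S) u λ i i∈I lvl≡u → <⇒≱ u<v (subst (v ≤_) lvl≡u (above i i∈I))

  admissible⇒zero-sum : ∀ k S I → ∣ I ∣ ≡ n → Admissible r (countIn k I (levels S)) → HasZeroSum k S
  admissible⇒zero-sum k S I card admissible
    with a , odd , n∣Σ ← zero-sum-weights {0} r k I S refl (λ _ _ → z≤n) admissible =
    I , a , nonempty , card , (λ i i∈I → odd⇒coprime-2^ r (odd i i∈I)) , n∣Σ
    where
    nonempty : Nonempty I
    nonempty with nonempty? I
    ... | yes ne = ne
    ... | no empty = contradiction (trans (sym card) (trans (cong ∣_∣ (Empty-unique empty)) (∣⊥∣≡0 k)))
                                   (m<n⇒n≢0 (<-trans (s≤s z≤n) 1<n))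

  selectable⇒zero-sum : ∀ k S → Selectable r n (count k (levels S)) → HasZeroSum k S
  selectable⇒zero-sum k S (j , j≤ , Σj , admissible) with I , I≗j ← countIn-select k (levels S) j j≤ =
    admissible⇒zero-sum k S I (trans (sym (countIn-total k I (λ i → lvl≤r (S i)))) (trans (sumUpTo-cong r I≗j) Σj))
      λ v v<r none-below → subst (2 ∣_) (sym (I≗j v))
        (admissible v v<r λ u u<v → trans (sym (I≗j u)) (none-below u u<v))

  zero-sum⇒selectable : ∀ k S → HasZeroSum k S → Selectable r n (count k (levels S))
  zero-sum⇒selectable k S zs with I , card , admissible ← zero-sum⇒admissible k S zs =
    countIn k I (levels S) , countIn≤count k I (levels S) , trans (countIn-total k I (λ i → lvl≤r (S i))) card , admissible

  canon : ℕ → Fin n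
  canon l with l <? r
  ... | yes l<r = fromℕ< (^-monoʳ-< 2 (s≤s (s≤s z≤n)) l<r)
  ... | no _ = fromℕ< (m^n>0 2 r)

  canon-spec : ∀ l → (l < r × toℕ (canon l) ≡ 2 ^ l) ⊎ (r ≤ l × toℕ (canon l) ≡ 0)
  canon-spec l with l <? r
  ... | yes l<r = inj₁ (l<r , toℕ-fromℕ< _)
  ... | no l≮r = inj₂ (≮⇒≥ l≮r , toℕ-fromℕ< _)

  lvl-≡ : ∀ x → toℕ x ≡ y → IsLevel r y l → lvl x ≡ l
  lvl-≡ x refl = level-unique (lvl-spec x)

  toℕ-canon : ∀ {l} → l < r → toℕ (canon l) ≡ 2 ^ l
  toℕ-canon {l} l<r with canon-spec l
  ... | inj₁ (_ , x≡) = x≡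
  ... | inj₂ (r≤l , _) = contradiction l<r (≤⇒≯ r≤l)

  toℕ-canon-top : toℕ (canon r) ≡ 0
  toℕ-canon-top with canon-spec r
  ... | inj₁ (r<r , _) = contradiction r<r (<-irrefl refl)
  ... | inj₂ (_ , x≡) = x≡

  lvl-canon : ∀ l → lvl (canon l) ≡ l ⊓ r
  lvl-canon l with canon-spec l
  ... | inj₁ (l<r , x≡) = lvl-≡ (canon l) x≡ (subst (IsLevel r _) (sym (m≤n⇒m⊓n≡m (<⇒≤ l<r))) (level-2^ l<r))
  ... | inj₂ (r≤l , x≡) = lvl-≡ (canon l) x≡ (subst (IsLevel r 0) (sym (m≥n⇒m⊓n≡n r≤l)) level-zero)

  PowerOrZero : Fin n → Set
  PowerOrZero x = toℕ x ≡ 0 ⊎ (Σ ℕ λ i → i < r × toℕ x ≡ 2 ^ i)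

  canon-powerOrZero : ∀ l → PowerOrZero (canon l)
  canon-powerOrZero l with canon-spec l
  ... | inj₁ (l<r , x≡) = inj₂ (l , l<r , x≡)
  ... | inj₂ (_ , x≡) = inj₁ x≡

  powerOrZero-δ : ∀ x → PowerOrZero x → ∀ {ℓ} → ℓ < r → δ (toℕ x) (2 ^ ℓ) ≡ δ (lvl x) ℓ
  powerOrZero-δ x power {ℓ} ℓ<r = δ-cong (λ x≡ → lvl-≡ x x≡ (level-2^ ℓ<r)) (⇐ power)
    where
    ⇐ : PowerOrZero x → lvl x ≡ ℓ → toℕ x ≡ 2 ^ ℓ
    ⇐ (inj₁ x≡0) lvl≡ℓ = contradiction (trans (sym (lvl-≡ x x≡0 level-zero)) lvl≡ℓ) (>⇒≢ ℓ<r)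
    ⇐ (inj₂ (i , i<r , x≡)) lvl≡ℓ = trans x≡ (cong (2 ^_) (trans (sym (lvl-≡ x x≡ (level-2^ i<r))) lvl≡ℓ))

  countVal≡count : ∀ k T → (∀ j → PowerOrZero (T j)) → ∀ {ℓ} → ℓ < r →
                   countVal n k T (2 ^ ℓ) ≡ count k (levels T) ℓ
  countVal≡count k T power ℓ<r = sumFin-cong k λ j → powerOrZero-δ (T j) (power j) ℓ<r

  ladder : ℕ → ∀ k → Fin k → Fin n
  ladder s (suc k) fzero = canon s
  ladder s (suc k) (fsuc i) = ladder (suc s) k i

  ladder-count-below : ∀ k s {ℓ} → ℓ < r → ℓ < s → count k (levels (ladder s k)) ℓ ≡ 0
  ladder-count-below zero s ℓ<r ℓ<s = refl
  ladder-count-below (suc k) s ℓ<r ℓ<s = cong₂ _+_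
    (δ-≢ (subst (_≢ _) (sym (lvl-canon s)) (>⇒≢ (⊓-pres-m< ℓ<s ℓ<r))))
    (ladder-count-below k (suc s) ℓ<r (m<n⇒m<1+n ℓ<s))

  ladder-count-≤1 : ∀ k s {ℓ} → ℓ < r → count k (levels (ladder s k)) ℓ ≤ 1
  ladder-count-≤1 zero s ℓ<r = z≤n
  ladder-count-≤1 (suc k) s {ℓ} ℓ<r with s ≟ ℓ
  ... | yes refl = ≤-reflexive (cong₂ _+_ (δ-≡ (trans (lvl-canon s) (m≤n⇒m⊓n≡m (<⇒≤ ℓ<r))))
                                          (ladder-count-below k (suc s) ℓ<r ≤-refl))
  ... | no s≢ℓ = subst (_≤ 1) (cong (_+ count k (levels (ladder (suc s) k)) ℓ) (sym (δ-≢ lvl≢ℓ)))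
                       (ladder-count-≤1 k (suc s) ℓ<r)
    where
    lvl≢ℓ : lvl (canon s) ≢ ℓ
    lvl≢ℓ rewrite lvl-canon s with ≤-total s r
    ... | inj₁ s≤r = subst (_≢ ℓ) (sym (m≤n⇒m⊓n≡m s≤r)) s≢ℓ
    ... | inj₂ r≤s = subst (_≢ ℓ) (sym (m≥n⇒m⊓n≡n r≤s)) (>⇒≢ ℓ<r)

  ladder-count-top-beyond : ∀ k {s} → r ≤ s → count k (levels (ladder s k)) r ≤ k ∸ (r ∸ s)
  ladder-count-top-beyond k {s} r≤s = subst (count k (levels (ladder s k)) r ≤_) (cong (k ∸_) (sym (m≤n⇒m∸n≡0 r≤s)))
                                            (count≤length k (levels (ladder s k)) r)

  ladder-count-top : ∀ k s → count k (levels (ladder s k)) r ≤ k ∸ (r ∸ s)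
  ladder-count-top zero s = z≤n
  ladder-count-top (suc k) s with <-cmp s r
  ... | tri< s<r _ _ = subst₂ _≤_ (cong (_+ count k (levels (ladder (suc s) k)) r) (sym (δ-≢ lvl≢r)))
                                 (cong (suc k ∸_) (sym (+-∸-assoc 1 s<r))) (ladder-count-top k (suc s))
    where
    lvl≢r : lvl (canon s) ≢ r
    lvl≢r = subst (_≢ r) (sym (trans (lvl-canon s) (m≤n⇒m⊓n≡m (<⇒≤ s<r)))) (<⇒≢ s<r)
  ... | tri≈ _ s≡r _ = ladder-count-top-beyond (suc k) (≤-reflexive (sym s≡r))
  ... | tri> _ _ r<s = ladder-count-top-beyond (suc k) (<⇒≤ r<s)

  2∣n : 2 ∣ n
  2∣n = divides (2 ^ g) (*-comm 2 (2 ^ g))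

  1≤n : 1 ≤ n
  1≤n = <⇒≤ 1<n

  ladder-lacks-zero-sum : k ≤ n + g → ¬ HasZeroSum k (ladder 0 k)
  ladder-lacks-zero-sum {k} k≤ zs = thin⇒unselectable g (count k (levels (ladder 0 k))) (0 , refl)
    (λ ℓ ℓ<g → ladder-count-≤1 k 0 (m<n⇒m<1+n ℓ<g)) (ladder-count-≤1 k 0 ≤-refl) top
    (zero-sum⇒selectable k (ladder 0 k) zs)
    where
    top : count k (levels (ladder 0 k)) r + 1 ≤ n
    top = begin
      count k (levels (ladder 0 k)) r + 1 ≤⟨ +-monoˡ-≤ 1 (≤-trans (ladder-count-top k 0) (∸-monoˡ-≤ r k≤)) ⟩
      n + g ∸ r + 1                       ≡⟨ cong (_+ 1) (pred[m∸n]≡m∸[1+n] (n + g) g) ⟨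
      pred (n + g ∸ g) + 1                ≡⟨ cong (λ z → pred z + 1) (m+n∸n≡m n g) ⟩
      pred n + 1                          ≡⟨ +-comm (pred n) 1 ⟩
      suc (pred n)                        ≡⟨ suc-pred n ⟩
      n                                   ∎
      where open ≤-Reasoning

  everyHasWZS[n+r] : EveryHasWZS n (U n) (n + r)
  everyHasWZS[n+r] S = selectable⇒zero-sum (n + r) S
    (selectable-if-long r (count (n + r) (levels S)) 2∣n 1≤n (≤-reflexive (sym (count-total (n + r) (λ i → lvl≤r (S i))))))

  everyHasWZS⇒n+r≤ : ∀ k → 1 ≤ k → EveryHasWZS n (U n) k → n + r ≤ k
  everyHasWZS⇒n+r≤ k _ every with n + r ≤? k
  ... | yes n+r≤k = n+r≤k
  ... | no n+r≰k = contradiction (every (ladder 0 k))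
    (ladder-lacks-zero-sum (≤-pred (subst (suc k ≤_) (+-suc n g) (≰⇒> n+r≰k))))

  isE[n+r] : IsE n (U n) (n + r)
  isE[n+r] = ≤-trans 1≤n (m≤m+n n r) , everyHasWZS[n+r] , everyHasWZS⇒n+r≤

  isE⇒≡n+r : ∀ {E} → IsE n (U n) E → E ≡ n + r
  isE⇒≡n+r (1≤E , every , least) =
    ≤-antisym (least (n + r) (≤-trans 1≤n (m≤m+n n r)) everyHasWZS[n+r]) (everyHasWZS⇒n+r≤ _ 1≤E every)

  equivalent⇒count≡ : ∀ k S T → AEquivalent n (U n) k S T → ∀ ℓ → count k (levels S) ℓ ≡ count k (levels T) ℓ
  equivalent⇒count≡ k S T (c , σ , a , unit-c , unit-a , rel) ℓ = trans
    (sumFin-cong k λ i → cong (λ l → δ l ℓ) (sym (level-invariant (lvl-spec (T (σ ⟨$⟩ʳ i))) (lvl-spec (S i))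
      (coprime-2^[1+e]⇒odd g unit-c) (coprime-2^[1+e]⇒odd g (unit-a i)) (rel i))))
    (sumFin-permute k (λ j → δ (lvl (T j)) ℓ) σ)

  canon-weight : ∀ x → Σ (Fin n) λ w → Odd (toℕ w) × (toℕ one * toℕ (canon (lvl x))) ≡[mod n ] (toℕ w * toℕ x)
  canon-weight x with lvl-spec x
  ... | inj₁ (x≡0 , lvl≡r) = one , odd-one , ≡mod-from {p = 0} {q = 0}
    (cong (λ z → toℕ one * z + n * 0) (trans (cong (toℕ ∘′ canon) lvl≡r) (trans toℕ-canon-top (sym x≡0))))
  ... | inj₂ (l<r , u , odd-u , x≡) with w , p , wu≡ ← odd-inverse r odd-u
    with a , odd-a , q , w≡ ← odd-residue g (inverse⇒odd {w} {u} {g} wu≡) = a , odd-a , ≡mod-from (begin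
      toℕ one * toℕ (canon (lvl x)) + n * (P * p) ≡⟨ cong₂ (λ o c → o * c + n * (P * p)) toℕ-one (toℕ-canon l<r) ⟩
      1 * P + n * (P * p)                         ≡⟨ step₁ P n p ⟩
      P * (1 + n * p)                             ≡⟨ cong (P *_) wu≡ ⟨
      P * (w * u)                                 ≡⟨ step₂ P w u ⟩
      w * (P * u)                                 ≡⟨ cong (w *_) x≡ ⟨
      w * toℕ x                                   ≡⟨ cong (_* toℕ x) w≡ ⟩
      (toℕ a + n * q) * toℕ x                     ≡⟨ step₃ (toℕ a) n q (toℕ x) ⟩
      toℕ a * toℕ x + n * (q * toℕ x)             ∎)
    where
    open ≡-Reasoning
    P = 2 ^ lvl x
    step₁ : ∀ P n p → 1 * P + n * (P * p) ≡ P * (1 + n * p)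
    step₁ = Ring.solve-∀
    step₂ : ∀ P w u → P * (w * u) ≡ w * (P * u)
    step₂ = Ring.solve-∀
    step₃ : ∀ a n q x → (a + n * q) * x ≡ a * x + n * (q * x)
    step₃ = Ring.solve-∀

  equivalent-to-canon : ∀ k S → AEquivalent n (U n) k S (λ i → canon (lvl (S i)))
  equivalent-to-canon k S = one , Permutation.id , (λ i → proj₁ (canon-weight (S i))) , odd⇒coprime-2^ r odd-one ,
    (λ i → odd⇒coprime-2^ r (proj₁ (proj₂ (canon-weight (S i))))) , (λ i → proj₂ (proj₂ (canon-weight (S i))))

  n+r∸1≡n+g : n + r ∸ 1 ≡ n + g
  n+r∸1≡n+g = cong (_∸ 1) (+-suc n g)

  extremal⇒canonical : ∀ k S → IsEExtremal n (U n) k S →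
                       k ≡ n + r ∸ 1 × Σ (Fin k → Fin n) λ T → CanonicalForm r k T × AEquivalent n (U n) k S T
  extremal⇒canonical k S (E , E-value , k+1≡E , no-zero-sum) =
    trans k≡n+g (sym n+r∸1≡n+g) , T ,
    ((λ ℓ ℓ<g → trans (count-T (m<n⇒m<1+n ℓ<g)) (ones ℓ ℓ<g)) ,
     (μ g , odd , odd⇒1≤ odd , subst (μ g ≤_) (pred[m∸n]≡m∸[1+n] n 0) (<⇒≤pred cg<n) , count-T ≤-refl) ,
     (λ i → canon-powerOrZero (lvl (S i)))) ,
    equivalent-to-canon k S
    where
    μ : ℕ → ℕ
    μ = count k (levels S)
    T : Fin k → Fin n
    T i = canon (lvl (S i))
    k≡n+g : k ≡ n + g
    k≡n+g = suc-injective (trans (+-comm 1 k) (trans k+1≡E (trans (isE⇒≡n+r E-value) (+-suc n g))))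
    shape : Shape g μ n
    shape = unselectable⇒shape g μ 2∣n 1≤n (trans (count-total k (λ i → lvl≤r (S i))) k≡n+g)
                               (no-zero-sum ∘′ selectable⇒zero-sum k S)
    ones = proj₁ shape
    odd = proj₁ (proj₂ shape)
    cg<n = proj₂ (proj₂ shape)
    count-T : ∀ {ℓ} → ℓ < r → countVal n k T (2 ^ ℓ) ≡ μ ℓ
    count-T ℓ<r = trans (countVal≡count k T (λ i → canon-powerOrZero (lvl (S i))) ℓ<r)
                        (sym (equivalent⇒count≡ k S T (equivalent-to-canon k S) _))

  canonical⇒extremal : ∀ k S →
                       (k ≡ n + r ∸ 1 × Σ (Fin k → Fin n) λ T → CanonicalForm r k T × AEquivalent n (U n) k S T) →
                       IsEExtremal n (U n) k S
  canonical⇒extremal k S (k≡ , T , (ones , (m , odd , _ , _ , count-m) , power) , equivalent) =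
    n + r , isE[n+r] , trans (cong (_+ 1) k≡n+g) (trans (+-comm (n + g) 1) (sym (+-suc n g))) ,
    thin⇒unselectable g μ odd (λ ℓ ℓ<g → ≤-reflexive (c≡1 ℓ ℓ<g)) (≤-reflexive cg≡m) top
      ∘′ zero-sum⇒selectable k S
    where
    μ : ℕ → ℕ
    μ = count k (levels S)
    k≡n+g : k ≡ n + g
    k≡n+g = trans k≡ n+r∸1≡n+g
    c≡count-T : ∀ {ℓ} → ℓ < r → μ ℓ ≡ countVal n k T (2 ^ ℓ)
    c≡count-T ℓ<r = trans (equivalent⇒count≡ k S T equivalent _) (sym (countVal≡count k T power ℓ<r))
    c≡1 : ∀ ℓ → ℓ < g → μ ℓ ≡ 1
    c≡1 ℓ ℓ<g = trans (c≡count-T (m<n⇒m<1+n ℓ<g)) (ones ℓ ℓ<g)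
    cg≡m : μ g ≡ m
    cg≡m = trans (c≡count-T ≤-refl) count-m
    top : μ r + m ≤ n
    top = ≤-reflexive (+-cancelˡ-≡ g _ _ (begin
      g + (μ r + m) ≡⟨ cong (g +_) (+-comm (μ r) m) ⟩
      g + (m + μ r) ≡⟨ cong (λ z → g + (z + μ r)) cg≡m ⟨
      g + (μ g + μ r) ≡⟨ sumUpTo-ones g μ c≡1 ⟨
      sumUpTo r μ   ≡⟨ count-total k (λ i → lvl≤r (S i)) ⟩
      k             ≡⟨ k≡n+g ⟩
      n + g         ≡⟨ +-comm n g ⟩
      g + n         ∎))
      where open ≡-Reasoning

mainTheorem6 : (r : ℕ) → 1 ≤ r → (k : ℕ) → (S : Fin k → Fin (2 ^ r)) →
    IsEExtremal (2 ^ r) (U (2 ^ r)) k S ⇔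
      (k ≡ 2 ^ r + r ∸ 1 × Σ (Fin k → Fin (2 ^ r)) λ T →
        CanonicalForm r k T × AEquivalent (2 ^ r) (U (2 ^ r)) k S T)
mainTheorem6 (suc g) _ k S = mk⇔ (extremal⇒canonical g k S) (canonical⇒extremal g k S)
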